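{- Let $T$ be the succinct $g$-Strahler $(\ell,h)$-universal tree. Then there exists a cover $\mathcal{C}$ of $\mathcal{T}$ such that $|\mathcal{C}_j|\le g$ for all $0\le j\le h$.
   Context: Ordered trees: prefix-closed sets of tuples over a linearly ordered set, viewed as rooted trees, ordered lexicographically, all leaves of a height-$h$ tree at depth $h$. $T\sqsubseteq T'$ if there is an injective, edge-preserving, order-preserving map $V(T)\to V(T')$ sending leaves to leaves; $T\equiv T'$ if both directions hold. Binary strings are ordered by $0s<\varepsilon<1s'$ and $bs<bs'\iff s<s'$. The succinct $g$-Strahler $(\ell,h)$-universal tree (with $g\le\min(h,\lfloor\log_2\ell\rfloor)$) has as leaves all $h$-tuples $\xi=(\xi_{2h-1},\xi_{2h-3},\dots,\xi_1)$ of binary strings such that: (1) exactly $g$ of the strings are nonempty; (2) the total number of bits is at most $g+\lfloor\log_2\ell\rfloor$; (3) for each odd $i\in[2h]$, writing $\xi|_i=(\xi_{2h-1},\dots,\xi_i)$: (a) if $\xi|_i$ contains $f<g$ nonempty strings and has exactly $f+\lfloor\log_2\ell\rfloor$ bits, then $\xi_i=0$; (b) if $\xi_{j'}\ne\varepsilon$ for all odd $j'\le i$, then $\xi_{j'}$ starts with $0$ for all odd $j'\le i$. The tree consists of all prefixes of these leaves. For $0\le j\le h$, $\mathcal{T}_j$ is the set of pairwise non-equivalent subtrees of $T$ rooted at vertices of depth $h-j$, $\mathcal{T}=\bigcup_j\mathcal{T}_j$. A cover of $\mathcal{T}$ is a tuple $\mathcal{C}=(\mathcal{C}_0,\dots,\mathcal{C}_h)$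 where each $\mathcal{C}_j$ is a tuple of chains of the poset $(\mathcal{T}_j,\sqsubseteq)$ whose union is $\mathcal{T}_j$. -}

module Defs where

open import Data.Bool using (Bool; true; false)
open import Data.List using (List; []; _∷_; _++_; _∷ʳ_; length; map)
open import Data.Nat.ListAction using (sum)
open import Data.List.Relation.Unary.All using (All)
open import Data.Nat using (ℕ; zero; suc; _+_; _≤_; _<_; _∸_)
open import Data.Nat.Logarithm using (⌊log₂_⌋)
open import Data.Fin using (Fin; toℕ)
open import Data.Product using (Σ; ∃; _×_)
open import Data.Sum using (_⊎_)
open import Relation.Nullary using (¬_)
open import Relation.Binary.PropositionalEquality using (_≡_)

BStr : Set
BStr = List Bool

infix 4 _<ₛ_
data _<ₛ_ : BStr → BStr → Set where
  0<ε  : ∀ {s} → false ∷ s <ₛ []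
  ε<1  : ∀ {s} → [] <ₛ true ∷ s
  0<1  : ∀ {s s'} → false ∷ s <ₛ true ∷ s'
  b<b  : ∀ {b s s'} → s <ₛ s' → b ∷ s <ₛ b ∷ s'

-- Vertices: finite tuples of binary strings; the root is [], the
-- children of v are  v ∷ʳ x.  Ordered trees are (prefix-closed) sets of
-- vertices, given as predicates.

Vtx : Set
Vtx = List BStr

Tree : Set₁
Tree = Vtx → Set

infix 4 _<ᵥ_
data _<ᵥ_ : Vtx → Vtx → Set where
  pre  : ∀ {x v} → [] <ᵥ x ∷ v
  head : ∀ {x y v w} → x <ₛ y → x ∷ v <ᵥ y ∷ w
  tail : ∀ {x v w} → v <ᵥ w → x ∷ v <ᵥ x ∷ w

IsChild : Vtx → Vtx → Set
IsChild p c = ∃ λ y → c ≡ p ∷ʳ y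

IsLeaf : Tree → Vtx → Set
IsLeaf T v = T v × (∀ x → ¬ T (v ∷ʳ x))

infix 4 _⊑_
record _⊑_ (T T' : Tree) : Set where
  field
    f      : Vtx → Vtx
    maps   : ∀ v → T v → T' (f v)
    inj    : ∀ u v → T u → T v → f u ≡ f v → u ≡ v
    edge   : ∀ u x → T u → T (u ∷ʳ x) → IsChild (f u) (f (u ∷ʳ x))
    order  : ∀ u v → T u → T v → u <ᵥ v → f u <ᵥ f v
    leaves : ∀ v → IsLeaf T v → IsLeaf T' (f v)

Sub : Tree → Vtx → Tree
Sub T u s = T (u ++ s)

-- The succinct g-Strahler (ℓ,h)-universal tree.
-- A leaf ξ = (ξ_{2h-1}, …, ξ_1) is the list of its strings, left to right.

nonEmpty : BStr → Set
nonEmpty s = ¬ (s ≡ [])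

startsWith0 : BStr → Set
startsWith0 s = ∃ λ t → s ≡ false ∷ t

#nz : List BStr → ℕ
#nz [] = 0
#nz ([] ∷ ξ) = #nz ξ
#nz ((_ ∷ _) ∷ ξ) = suc (#nz ξ)

bits : List BStr → ℕ
bits ξ = sum (map length ξ)

record IsULeaf (ℓ h g : ℕ) (ξ : List BStr) : Set where
  field
    len   : length ξ ≡ h
    cond1 : #nz ξ ≡ g
    cond2 : bits ξ ≤ g + ⌊log₂ ℓ ⌋
    -- ξ = p ++ x ∷ r  means  ξ|_i = p ∷ʳ x  and  ξ_i = x
    cond3a : ∀ p x r → ξ ≡ p ++ x ∷ r →
             #nz (p ∷ʳ x) < g →
             bits (p ∷ʳ x) ≡ #nz (p ∷ʳ x) + ⌊log₂ ℓ ⌋ →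
             x ≡ false ∷ []
    cond3b : ∀ p x r → ξ ≡ p ++ x ∷ r →
             All nonEmpty (x ∷ r) → All startsWith0 (x ∷ r)

UTree : ℕ → ℕ → ℕ → Tree
UTree ℓ h g v = ∃ λ s → IsULeaf ℓ h g (v ++ s)

-- T_j consists of the classes (up to ≡) of subtrees rooted at
-- depth h - j.  A chain of (T_j, ⊑) is represented by a set of vertices
-- of depth h - j (representatives) whose subtrees are pairwise
-- ⊑-comparable; a family of chains covers T_j iff every vertex of depth
-- h - j lies in one of them.

record LevelCover (T : Tree) (d : ℕ) : Set₁ where
  field
    size    : ℕ
    chain   : Fin size → Vtx → Set
    atLevel : ∀ k v → chain k v → T v × length v ≡ d
    isChain : ∀ k u v → chain k u → chain k v →
              (Sub T u ⊑ Sub T v) ⊎ (Sub T v ⊑ Sub T u)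
    covers  : ∀ v → T v → length v ≡ d → ∃ λ k → chain k v

Cover : Tree → ℕ → Set₁
Cover T h = (j : Fin (suc h)) → LevelCover T (h ∸ toℕ j)

{-# OPTIONS --safe #-}
-- At a fixed depth, two vertices u, u' with the same number of nonempty
-- strings have comparable subtrees, and the identity map is the embedding:
-- if u' uses no more bits than u, then every leaf u ++ w below u gives a
-- leaf u' ++ w below u'.  The only delicate condition is (3a): a prefix
-- of u' ++ w using exactly f + ⌊log₂ ℓ⌋ bits forces the corresponding
-- prefix of u ++ w to do so as well, because no prefix of a leaf can use
-- more.  A vertex whose strings already contain all g nonempty ones roots
-- a path of empty strings, which embeds into every subtree at its depth.
-- Grouping the vertices of a level by their number f ≤ g of nonempty
-- strings, with f = g merged into f = g - 1, therefore yields g chains.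
module Submission where

open import Algebra.Properties.CommutativeSemigroup using (xy∙z≈xz∙y)
open import Data.Bool using (Bool; false)
open import Data.Empty using (⊥-elim)
open import Data.Fin using (Fin; toℕ; fromℕ; fromℕ<)
open import Data.Fin.Properties using (toℕ-fromℕ; toℕ-fromℕ<)
open import Data.List using (List; []; _∷_; _++_; _∷ʳ_; [_]; length; map; take; drop; replicate)
open import Data.List.Properties
  using (map-++; length-++; ++-assoc; ++-identityʳ; ∷-injective; take++drop≡id; take-all; length-take)
open import Data.List.Relation.Unary.All using (All; []; _∷_)
open import Data.List.Relation.Unary.All.Properties using (++⁺; ++⁻ˡ; ++⁻ʳ)
open import Data.Nat using (ℕ; zero; suc; _+_; _∸_; _≤_; _<_; z≤n; s≤s)
open import Data.Nat.ListAction using (sum)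
open import Data.Nat.ListAction.Properties using (sum-++)
open import Data.Nat.Logarithm using (⌊log₂_⌋)
open import Data.Nat.Properties
open import Data.Product using (Σ; ∃; _×_; _,_; proj₁)
open import Data.Sum using (_⊎_; inj₁; inj₂)
open import Relation.Binary.PropositionalEquality hiding ([_])

open import Defs

#nz-++ : ∀ a b → #nz (a ++ b) ≡ #nz a + #nz b
#nz-++ []             b = refl
#nz-++ ([] ∷ a)       b = #nz-++ a b
#nz-++ ((_ ∷ _) ∷ a)  b = cong suc (#nz-++ a b)

bits-++ : ∀ a b → bits (a ++ b) ≡ bits a + bits b
bits-++ a b = trans (cong sum (map-++ length a b)) (sum-++ (map length a) (map length b))

#nz≤bits : ∀ a → #nz a ≤ bits a
#nz≤bits []            = z≤n
#nz≤bits ([] ∷ a)      = #nz≤bits a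
#nz≤bits ((_ ∷ s) ∷ a) = s≤s (≤-trans (#nz≤bits a) (m≤n+m (bits a) (length s)))

#nz≤length : ∀ a → #nz a ≤ length a
#nz≤length []            = z≤n
#nz≤length ([] ∷ a)      = m≤n⇒m≤1+n (#nz≤length a)
#nz≤length ((_ ∷ _) ∷ a) = s≤s (#nz≤length a)

#nz≡length⇒All-nonEmpty : ∀ a → #nz a ≡ length a → All nonEmpty a
#nz≡length⇒All-nonEmpty []            _ = []
#nz≡length⇒All-nonEmpty ([] ∷ a)      e = ⊥-elim (<⇒≱ (s≤s (#nz≤length a)) (≤-reflexive (sym e)))
#nz≡length⇒All-nonEmpty ((_ ∷ _) ∷ a) e = (λ ()) ∷ #nz≡length⇒All-nonEmpty a (suc-injective e)

All-nonEmpty⇒#nz≡length : ∀ a → All nonEmpty a → #nz a ≡ length a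
All-nonEmpty⇒#nz≡length []            _        = refl
All-nonEmpty⇒#nz≡length ([] ∷ a)      (ne ∷ _) = ⊥-elim (ne refl)
All-nonEmpty⇒#nz≡length ((_ ∷ _) ∷ a) (_ ∷ ne) = cong suc (All-nonEmpty⇒#nz≡length a ne)

#nz≡0⇒replicate : ∀ a → #nz a ≡ 0 → a ≡ replicate (length a) []
#nz≡0⇒replicate []       _ = refl
#nz≡0⇒replicate ([] ∷ a) e = cong ([] ∷_) (#nz≡0⇒replicate a e)

module _ {A : Set} (f : List A → ℕ) (f-++ : ∀ a b → f (a ++ b) ≡ f a + f b) where

  additive-swapPrefix : ∀ u u' w → f u ≡ f u' → f (u' ++ w) ≡ f (u ++ w)
  additive-swapPrefix u u' w e = begin
    f (u' ++ w)  ≡⟨ f-++ u' w ⟩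
    f u' + f w   ≡⟨ cong (_+ f w) (sym e) ⟩
    f u + f w    ≡⟨ f-++ u w ⟨
    f (u ++ w)   ∎
    where open ≡-Reasoning

  additive-cancelPrefix : ∀ u u' w t → f u ≡ f u' → f (u ++ w) ≡ f (u' ++ t) → f w ≡ f t
  additive-cancelPrefix u u' w t e e' = +-cancelˡ-≡ (f u) (f w) (f t) (begin
    f u + f w    ≡⟨ f-++ u w ⟨
    f (u ++ w)   ≡⟨ e' ⟩
    f (u' ++ t)  ≡⟨ additive-swapPrefix u u' t e ⟩
    f (u ++ t)   ≡⟨ f-++ u t ⟩
    f u + f t    ∎)
    where open ≡-Reasoning

++-≡-++-∷-cases : ∀ {A : Set} (a b p : List A) x r → a ++ b ≡ p ++ x ∷ r →
  (∃ λ a₂ → a ≡ p ++ x ∷ a₂ × r ≡ a₂ ++ b) ⊎ (∃ λ p₁ → p ≡ a ++ p₁ × b ≡ p₁ ++ x ∷ r)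
++-≡-++-∷-cases []      b p       x r e    = inj₂ (p , refl , e)
++-≡-++-∷-cases (_ ∷ a) b []      x r refl = inj₁ (a , refl , refl)
++-≡-++-∷-cases (_ ∷ a) b (_ ∷ p) x r e with refl , e′ ← ∷-injective e
  with ++-≡-++-∷-cases a b p x r e′
... | inj₁ (a₂ , refl , e₂) = inj₁ (a₂ , refl , e₂)
... | inj₂ (p₁ , refl , e₂) = inj₂ (p₁ , refl , e₂)

length-∷ʳ : ∀ {A : Set} (s : List A) x → length (s ∷ʳ x) ≡ suc (length s)
length-∷ʳ s x = trans (length-++ s) (+-comm (length s) 1)

length-take-≤ : ∀ {A : Set} i (t : List A) → i ≤ length t → length (take i t) ≡ i
length-take-≤ i t i≤ = trans (length-take i t) (m≤n⇒m⊓n≡m i≤)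

take-suc-∷ʳ : ∀ {A : Set} i (t : List A) → i < length t → ∃ λ y → take (suc i) t ≡ take i t ∷ʳ y
take-suc-∷ʳ zero    (x ∷ t) _       = x , refl
take-suc-∷ʳ (suc i) (x ∷ t) (s≤s p) with y , e ← take-suc-∷ʳ i t p = y , cong (x ∷_) e

take-mono-<ᵥ : ∀ i j (t : Vtx) → i < j → j ≤ length t → take i t <ᵥ take j t
take-mono-<ᵥ zero    (suc j) (_ ∷ t) _       _       = pre
take-mono-<ᵥ (suc i) (suc j) (_ ∷ t) (s≤s p) (s≤s q) = tail (take-mono-<ᵥ i j t p q)

replicate-<ᵥ⇒< : ∀ a b → replicate a ([] {A = Bool}) <ᵥ replicate b [] → a < b
replicate-<ᵥ⇒< zero    (suc b) pre      = s≤s z≤n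
replicate-<ᵥ⇒< (suc a) (suc b) (head ())
replicate-<ᵥ⇒< (suc a) (suc b) (tail p) = s≤s (replicate-<ᵥ⇒< a b p)

module UniversalTree (ℓ h g : ℕ) where
  open IsULeaf

  private
    L : ℕ
    L = ⌊log₂ ℓ ⌋

    Leaf : List BStr → Set
    Leaf = IsULeaf ℓ h g

    T : Tree
    T = UTree ℓ h g

  prefix-bits≤ : ∀ q r → Leaf (q ++ r) → bits q ≤ #nz q + L
  prefix-bits≤ q r lf = +-cancelʳ-≤ (#nz r) (bits q) (#nz q + L) (begin
    bits q + #nz r        ≤⟨ +-monoʳ-≤ (bits q) (#nz≤bits r) ⟩
    bits q + bits r       ≡⟨ bits-++ q r ⟨
    bits (q ++ r)         ≤⟨ cond2 lf ⟩
    g + L                 ≡⟨ cong (_+ L) (trans (sym (cond1 lf)) (#nz-++ q r)) ⟩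
    #nz q + #nz r + L     ≡⟨ xy∙z≈xz∙y +-commutativeSemigroup (#nz q) (#nz r) L ⟩
    #nz q + L + #nz r     ∎)
    where open ≤-Reasoning

  tight-transfer : ∀ q q' r → Leaf (q ++ r) → #nz q' ≡ #nz q → bits q' ≤ bits q →
                   bits q' ≡ #nz q' + L → bits q ≡ #nz q + L
  tight-transfer q q' r lf en eb tight = ≤-antisym (prefix-bits≤ q r lf) (begin
    #nz q + L   ≡⟨ cong (_+ L) en ⟨
    #nz q' + L  ≡⟨ tight ⟨
    bits q'     ≤⟨ eb ⟩
    bits q      ∎)
    where open ≤-Reasoning

  suffix-startsWith0 : ∀ u w → Leaf (u ++ w) → All nonEmpty w → All startsWith0 w
  suffix-startsWith0 u []      lf _  = []
  suffix-startsWith0 u (x ∷ w) lf ne = cond3b lf u x w refl ne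

  replacePrefix : ∀ u u' w t → Leaf (u ++ w) → Leaf (u' ++ t) →
                  length u ≡ length u' → #nz u ≡ #nz u' → bits u' ≤ bits u →
                  Leaf (u' ++ w)
  replacePrefix u u' w t lf lf' el en eb = record
    { len    = trans (additive-swapPrefix length (λ a _ → length-++ a) u u' w el) (len lf)
    ; cond1  = trans (additive-swapPrefix #nz #nz-++ u u' w en) (cond1 lf)
    ; cond2  = ≤-trans (bits-prefix-≤ w) (cond2 lf)
    ; cond3a = preserves3a
    ; cond3b = preserves3b }
    where
    bits-prefix-≤ : ∀ a → bits (u' ++ a) ≤ bits (u ++ a)
    bits-prefix-≤ a = begin
      bits (u' ++ a)      ≡⟨ bits-++ u' a ⟩
      bits u' + bits a    ≤⟨ +-monoˡ-≤ (bits a) eb ⟩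
      bits u + bits a     ≡⟨ bits-++ u a ⟨
      bits (u ++ a)       ∎
      where open ≤-Reasoning

    preserves3a : ∀ p x r → u' ++ w ≡ p ++ x ∷ r → #nz (p ∷ʳ x) < g →
          bits (p ∷ʳ x) ≡ #nz (p ∷ʳ x) + L → x ≡ false ∷ []
    preserves3a p x r e few tight with ++-≡-++-∷-cases u' w p x r e
    ... | inj₁ (a₂ , refl , refl) = cond3a lf' p x (a₂ ++ t) (++-assoc p (x ∷ a₂) t) few tight
    ... | inj₂ (p₁ , refl , refl) =
      cond3a lf (u ++ p₁) x r (sym (++-assoc u p₁ (x ∷ r))) (subst (_< g) nz-eq few)
        (tight-transfer q q' r leaf nz-eq bits-≤ tight)
      where
      q q' : List BStr
      q  = (u ++ p₁) ∷ʳ x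
      q' = (u' ++ p₁) ∷ʳ x

      leaf : Leaf (q ++ r)
      leaf = subst Leaf (sym (trans (++-assoc (u ++ p₁) [ x ] r) (++-assoc u p₁ (x ∷ r)))) lf

      nz-eq : #nz q' ≡ #nz q
      nz-eq = begin
        #nz q'                 ≡⟨ cong #nz (++-assoc u' p₁ [ x ]) ⟩
        #nz (u' ++ p₁ ∷ʳ x)    ≡⟨ additive-swapPrefix #nz #nz-++ u u' (p₁ ∷ʳ x) en ⟩
        #nz (u ++ p₁ ∷ʳ x)     ≡⟨ cong #nz (++-assoc u p₁ [ x ]) ⟨
        #nz q                  ∎
        where open ≡-Reasoning

      bits-≤ : bits q' ≤ bits q
      bits-≤ = begin
        bits q'                ≡⟨ cong bits (++-assoc u' p₁ [ x ]) ⟩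
        bits (u' ++ p₁ ∷ʳ x)   ≤⟨ bits-prefix-≤ (p₁ ∷ʳ x) ⟩
        bits (u ++ p₁ ∷ʳ x)    ≡⟨ cong bits (++-assoc u p₁ [ x ]) ⟨
        bits q                 ∎
        where open ≤-Reasoning

    preserves3b : ∀ p x r → u' ++ w ≡ p ++ x ∷ r → All nonEmpty (x ∷ r) → All startsWith0 (x ∷ r)
    preserves3b p x r e ne with ++-≡-++-∷-cases u' w p x r e
    ... | inj₂ (p₁ , refl , refl) = cond3b lf (u ++ p₁) x r (sym (++-assoc u p₁ (x ∷ r))) ne
    ... | inj₁ (a₂ , refl , refl) =
      ++⁺ (++⁻ˡ (x ∷ a₂) (cond3b lf' p x (a₂ ++ t) (++-assoc p (x ∷ a₂) t) (++⁺ (++⁻ˡ (x ∷ a₂) ne) ne-t)))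
          (suffix-startsWith0 u w lf ne-w)
      where
      ne-w : All nonEmpty w
      ne-w = ++⁻ʳ (x ∷ a₂) ne
      ne-t : All nonEmpty t
      ne-t = #nz≡length⇒All-nonEmpty t (begin
        #nz t     ≡⟨ additive-cancelPrefix #nz #nz-++ u u' w t en (trans (cond1 lf) (sym (cond1 lf')) ) ⟨
        #nz w     ≡⟨ All-nonEmpty⇒#nz≡length w ne-w ⟩
        length w  ≡⟨ additive-cancelPrefix length (λ a _ → length-++ a) u u' w t el (trans (len lf) (sym (len lf'))) ⟩
        length t  ∎)
        where open ≡-Reasoning

  depth≤h : ∀ v → T v → length v ≤ h
  depth≤h v (s , lf) = begin
    length v             ≤⟨ m≤m+n (length v) (length s) ⟩
    length v + length s  ≡⟨ length-++ v ⟨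
    length (v ++ s)      ≡⟨ len lf ⟩
    h                    ∎
    where open ≤-Reasoning

  #nz≤g : ∀ v → T v → #nz v ≤ g
  #nz≤g v (s , lf) = begin
    #nz v          ≤⟨ m≤m+n (#nz v) (#nz s) ⟩
    #nz v + #nz s  ≡⟨ #nz-++ v s ⟨
    #nz (v ++ s)   ≡⟨ cond1 lf ⟩
    g              ∎
    where open ≤-Reasoning

  depthBelow≤ : ∀ v v' t s → Leaf (v' ++ t) → length v ≡ length v' → Sub T v s → length s ≤ length t
  depthBelow≤ v v' t s lf' el Ts = +-cancelˡ-≤ (length v) (length s) (length t) (begin
    length v + length s   ≡⟨ length-++ v ⟨
    length (v ++ s)       ≤⟨ depth≤h (v ++ s) Ts ⟩
    h                     ≡⟨ len lf' ⟨
    length (v' ++ t)      ≡⟨ additive-swapPrefix length (λ a _ → length-++ a) v v' t el ⟩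
    length (v ++ t)       ≡⟨ length-++ v ⟩
    length v + length t   ∎)
    where open ≤-Reasoning

  maxDepth⇒isLeaf : ∀ u s → Sub T u s → length (u ++ s) ≡ h → IsLeaf (Sub T u) s
  maxDepth⇒isLeaf u s Ts e = Ts , λ x Tx → <⇒≱ (n<1+n h) (begin
    suc h                  ≡⟨ cong suc e ⟨
    suc (length (u ++ s))  ≡⟨ length-∷ʳ (u ++ s) x ⟨
    length ((u ++ s) ∷ʳ x) ≡⟨ cong length (++-assoc u s [ x ]) ⟩
    length (u ++ s ∷ʳ x)   ≤⟨ depth≤h (u ++ s ∷ʳ x) Tx ⟩
    h                      ∎)
    where open ≤-Reasoning

  isLeaf⇒maxDepth : ∀ u s → IsLeaf (Sub T u) s → length (u ++ s) ≡ h
  isLeaf⇒maxDepth u s (([] , lf) , _) = trans (cong length (sym (++-identityʳ (u ++ s)))) (len lf)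
  isLeaf⇒maxDepth u s ((x ∷ r , lf) , noChild) = ⊥-elim (noChild x (r , subst Leaf rebracket lf))
    where
    rebracket : (u ++ s) ++ x ∷ r ≡ (u ++ s ∷ʳ x) ++ r
    rebracket = begin
      (u ++ s) ++ x ∷ r      ≡⟨ ++-assoc u s (x ∷ r) ⟩
      u ++ s ++ x ∷ r        ≡⟨ cong (u ++_) (++-assoc s [ x ] r) ⟨
      u ++ (s ∷ʳ x) ++ r     ≡⟨ ++-assoc u (s ∷ʳ x) r ⟨
      (u ++ s ∷ʳ x) ++ r     ∎
      where open ≡-Reasoning

  fewerBits⇒⊑ : ∀ u u' → T u' → length u ≡ length u' → #nz u ≡ #nz u' → bits u' ≤ bits u →
                Sub T u ⊑ Sub T u'
  fewerBits⇒⊑ u u' (t , lf') el en eb = record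
    { f      = λ s → s
    ; maps   = maps
    ; inj    = λ _ _ _ _ e → e
    ; edge   = λ _ x _ _ → x , refl
    ; order  = λ _ _ _ _ o → o
    ; leaves = λ s isLeaf → maxDepth⇒isLeaf u' s (maps s (proj₁ isLeaf))
                 (trans (additive-swapPrefix length (λ a _ → length-++ a) u u' s el) (isLeaf⇒maxDepth u s isLeaf)) }
    where
    maps : ∀ s → Sub T u s → Sub T u' s
    maps s (r , lf) = r , subst Leaf (sym (++-assoc u' s r))
      (replacePrefix u u' (s ++ r) t (subst Leaf (++-assoc u s r) lf) lf' el en eb)

  saturated⇒below-replicate : ∀ v s → #nz v ≡ g → Sub T v s → s ≡ replicate (length s) []
  saturated⇒below-replicate v s env (r , lf) =
    #nz≡0⇒replicate s (m+n≡0⇒m≡0 (#nz s) (+-cancelˡ-≡ (#nz v) (#nz s + #nz r) 0 (begin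
      #nz v + (#nz s + #nz r)  ≡⟨ +-assoc (#nz v) (#nz s) (#nz r) ⟨
      #nz v + #nz s + #nz r    ≡⟨ cong (_+ #nz r) (#nz-++ v s) ⟨
      #nz (v ++ s) + #nz r     ≡⟨ #nz-++ (v ++ s) r ⟨
      #nz ((v ++ s) ++ r)      ≡⟨ cond1 lf ⟩
      g                        ≡⟨ env ⟨
      #nz v                    ≡⟨ +-identityʳ (#nz v) ⟨
      #nz v + 0                ∎)))
    where open ≡-Reasoning

  -- Below a saturated v every vertex is a tuple of empty strings, so the
  -- subtree is a path; it is mapped onto the prefixes of any leaf below v'.
  saturated⇒⊑ : ∀ v v' → #nz v ≡ g → T v' → length v ≡ length v' → Sub T v ⊑ Sub T v'
  saturated⇒⊑ v v' env (t , lf') el = record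
    { f = F ; maps = maps ; inj = inj ; edge = edge ; order = order ; leaves = leaves }
    where
    F : Vtx → Vtx
    F s = take (length s) t

    replicate-below : ∀ s → Sub T v s → s ≡ replicate (length s) []
    replicate-below s = saturated⇒below-replicate v s env

    depth-below : ∀ s → Sub T v s → length s ≤ length t
    depth-below s = depthBelow≤ v v' t s lf' el

    maps : ∀ s → Sub T v s → Sub T v' (F s)
    maps s _ = drop (length s) t , subst Leaf
      (sym (trans (++-assoc v' (F s) (drop (length s) t)) (cong (v' ++_) (take++drop≡id (length s) t)))) lf'

    inj : ∀ s s' → Sub T v s → Sub T v s' → F s ≡ F s' → s ≡ s'
    inj s s' Ts Ts' e = begin
      s                           ≡⟨ replicate-below s Ts ⟩
      replicate (length s) []     ≡⟨ cong (λ n → replicate n []) same-length ⟩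
      replicate (length s') []    ≡⟨ replicate-below s' Ts' ⟨
      s'                          ∎
      where
      open ≡-Reasoning
      same-length : length s ≡ length s'
      same-length = begin
        length s      ≡⟨ length-take-≤ (length s) t (depth-below s Ts) ⟨
        length (F s)  ≡⟨ cong length e ⟩
        length (F s') ≡⟨ length-take-≤ (length s') t (depth-below s' Ts') ⟩
        length s'     ∎

    edge : ∀ s x → Sub T v s → Sub T v (s ∷ʳ x) → IsChild (F s) (F (s ∷ʳ x))
    edge s x _ Tsx
      with y , e ← take-suc-∷ʳ (length s) t (subst (_≤ length t) (length-∷ʳ s x) (depth-below (s ∷ʳ x) Tsx))
      = y , trans (cong (λ n → take n t) (length-∷ʳ s x)) e

    order : ∀ s s' → Sub T v s → Sub T v s' → s <ᵥ s' → F s <ᵥ F s'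
    order s s' Ts Ts' s<s' = take-mono-<ᵥ (length s) (length s') t
      (replicate-<ᵥ⇒< (length s) (length s') (subst₂ _<ᵥ_ (replicate-below s Ts) (replicate-below s' Ts') s<s'))
      (depth-below s' Ts')

    leaves : ∀ s → IsLeaf (Sub T v) s → IsLeaf (Sub T v') (F s)
    leaves s isLeaf = subst (IsLeaf (Sub T v')) (sym (take-all (length s) t (≤-reflexive depth-t≡s)))
      (maxDepth⇒isLeaf v' t ([] , subst Leaf (sym (++-identityʳ (v' ++ t))) lf') (len lf'))
      where
      depth-t≡s : length t ≡ length s
      depth-t≡s = additive-cancelPrefix length (λ a _ → length-++ a) v' v t s (sym el)
        (trans (len lf') (sym (isLeaf⇒maxDepth v s isLeaf)))

module _ (ℓ h g' : ℕ) where
  open UniversalTree ℓ h (suc g')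

  private
    T : Tree
    T = UTree ℓ h (suc g')

  InChain : Fin (suc g') → Vtx → Set
  InChain k w = #nz w ≡ toℕ k ⊎ (toℕ k ≡ g' × #nz w ≡ suc g')

  inChain-comparable : ∀ k u w → T u → T w → length u ≡ length w → InChain k u → InChain k w →
                       (Sub T u ⊑ Sub T w) ⊎ (Sub T w ⊑ Sub T u)
  inChain-comparable k u w _  Tw el (inj₂ (_ , sat)) _                = inj₁ (saturated⇒⊑ u w sat Tw el)
  inChain-comparable k u w Tu _  el (inj₁ _)         (inj₂ (_ , sat)) = inj₂ (saturated⇒⊑ w u sat Tu (sym el))
  inChain-comparable k u w Tu Tw el (inj₁ nu)        (inj₁ nw) with ≤-total (bits u) (bits w)
  ... | inj₁ u≤w = inj₂ (fewerBits⇒⊑ w u Tu (sym el) (trans nw (sym nu)) u≤w)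
  ... | inj₂ w≤u = inj₁ (fewerBits⇒⊑ u w Tw el (trans nu (sym nw)) w≤u)

  inChain-covers : ∀ w → T w → ∃ λ k → InChain k w
  inChain-covers w Tw with m≤n⇒m<n∨m≡n (#nz≤g w Tw)
  ... | inj₁ unsat = fromℕ< unsat , inj₁ (sym (toℕ-fromℕ< unsat))
  ... | inj₂ sat   = fromℕ g' , inj₂ (toℕ-fromℕ g' , sat)

  levelCover : ∀ d → LevelCover T d
  levelCover d = record
    { size    = suc g'
    ; chain   = λ k w → T w × length w ≡ d × InChain k w
    ; atLevel = λ _ _ (Tw , lw , _) → Tw , lw
    ; isChain = λ k u w (Tu , lu , cu) (Tw , lw , cw) → inChain-comparable k u w Tu Tw (trans lu (sym lw)) cu cw
    ; covers  = λ w Tw lw → let k , cw = inChain-covers w Tw in k , Tw , lw , cw }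

-- The hypotheses g ≤ h and g ≤ ⌊log₂ ℓ⌋ only guarantee that the tree is
-- nonempty; the cover exists without them.
lemma4p20 : (ℓ h g : ℕ) → 1 ≤ g → g ≤ h → g ≤ ⌊log₂ ℓ ⌋ →
    Σ (Cover (UTree ℓ h g) h)
    (λ C → (j : Fin _) → LevelCover.size (C j) ≤ g)
lemma4p20 ℓ h (suc g') (s≤s z≤n) _ _ = (λ j → levelCover ℓ h g' (h ∸ toℕ j)) , λ _ → ≤-refl
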